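{- Let $G$ be a finite simple graph on $n\ge 3$ vertices with no isolated vertices. Then $t(1,n)\le t(G)\le t(2,n)$.
   Context: For a finite simple graph $G$, a $G$-CFF$(t,|V(G)|)$ is a family of subsets $B_v\subseteq[1,t]=\{1,\dots,t\}$, one for each vertex $v$, such that for every edge $\{a,b\}$: (i) $B_a\not\subseteq B_b$ and $B_b\not\subseteq B_a$, and (ii) for every vertex $w\notin\{a,b\}$, $B_w\not\subseteq B_a\cup B_b$. $t(G)$ is the minimum $t$ for which a $G$-CFF$(t,|V(G)|)$ exists. $t(1,n)$ is the minimum $t$ such that there exist $n$ subsets $B_1,\dots,B_n$ of $[1,t]$ with $B_i\not\subseteq B_j$ for all $i\ne j$; equivalently $t(1,n)=\min\{t:\binom{t}{\lfloor t/2\rfloor}\ge n\}$. For $n\ge3$, $t(2,n)$ is the minimum $t$ such that there exist $n$ subsets $B_1,\dots,B_n$ of $[1,t]$ with $B_i\not\subseteq B_j\cup B_k$ for all pairwise distinct $i,j,k$. -}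

module Defs where

open import Data.Nat using (ℕ; _≤_)
open import Data.Fin using (Fin)
open import Data.Fin.Subset using (Subset; _⊆_; _∪_)
open import Data.Product using (Σ; ∃; _×_)
open import Relation.Nullary using (¬_)
open import Relation.Binary.PropositionalEquality using (_≡_; _≢_)

record SimpleGraph (n : ℕ) : Set₁ where
  field
    Adj    : Fin n → Fin n → Set
    sym    : ∀ {a b} → Adj a b → Adj b a
    irrefl : ∀ a → ¬ Adj a a

open SimpleGraph public

NoIsolated : ∀ {n} → SimpleGraph n → Set
NoIsolated {n} G = ∀ (v : Fin n) → ∃ λ (u : Fin n) → Adj G v u

IsGCFF : ∀ {n} → SimpleGraph n → (t : ℕ) → (Fin n → Subset t) → Set
IsGCFF {n} G t B =
  ∀ (a b : Fin n) → Adj G a b →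
    ¬ (B a ⊆ B b) × ¬ (B b ⊆ B a) ×
    (∀ (w : Fin n) → w ≢ a → w ≢ b → ¬ (B w ⊆ B a ∪ B b))

HasGCFF : ∀ {n} → SimpleGraph n → ℕ → Set
HasGCFF {n} G t = Σ (Fin n → Subset t) (IsGCFF G t)

Is1CFF : (n t : ℕ) → (Fin n → Subset t) → Set
Is1CFF n t B = ∀ (i j : Fin n) → i ≢ j → ¬ (B i ⊆ B j)

Has1CFF : ℕ → ℕ → Set
Has1CFF n t = Σ (Fin n → Subset t) (Is1CFF n t)

Is2CFF : (n t : ℕ) → (Fin n → Subset t) → Set
Is2CFF n t B = ∀ (i j k : Fin n) → i ≢ j → i ≢ k → j ≢ k → ¬ (B i ⊆ B j ∪ B k)

Has2CFF : ℕ → ℕ → Set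
Has2CFF n t = Σ (Fin n → Subset t) (Is2CFF n t)

IsMinimum : (ℕ → Set) → ℕ → Set
IsMinimum P m = P m × (∀ s → P s → m ≤ s)

IsTG : ∀ {n} → SimpleGraph n → ℕ → Set
IsTG G = IsMinimum (HasGCFF G)

IsT1 : ℕ → ℕ → Set
IsT1 n = IsMinimum (Has1CFF n)

IsT2 : ℕ → ℕ → Set
IsT2 n = IsMinimum (Has2CFF n)

-- For t(1,n) ≤ t(G):
-- if B u ⊆ B v, take a neighbour w of v; either w = u, contradicting the
-- edge condition on {v,u}, or B u ⊆ B v ∪ B w, contradicting the cover
-- condition on {v,w}.  For t(G) ≤ t(2,n): every condition of a G-CFF is an
-- instance of the 2-cover-free property, the containment B a ⊆ B b being
-- weakened to B a ⊆ B b ∪ B k for a third vertex k, which exists as n ≥ 3.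
module Submission where

open import Defs
open import Data.Nat using (ℕ; _≤_; s≤s; suc)
open import Data.Product using (_×_; _,_; ∃; proj₁)
open import Data.Fin using (Fin; zero; suc; _≟_)
open import Data.Fin.Subset using (Subset; _⊆_)
open import Data.Fin.Subset.Properties using (p⊆p∪q)
open import Relation.Nullary using (yes; no)
open import Relation.Binary.PropositionalEquality using (_≢_; refl; ≢-sym)

∃-≢-both : ∀ {n} → 3 ≤ n → (a b : Fin n) → ∃ λ k → k ≢ a × k ≢ b
∃-≢-both {suc (suc (suc _))} _ a b with zero ≟ a | zero ≟ b
... | no 0≢a | no 0≢b = zero , 0≢a , 0≢b
... | yes refl | _ with suc zero ≟ b
...   | no 1≢b   = suc zero , (λ ()) , 1≢b
...   | yes refl = suc (suc zero) , (λ ()) , (λ ())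
∃-≢-both {suc (suc (suc _))} _ a b | no _ | yes refl with suc zero ≟ a
...   | no 1≢a   = suc zero , 1≢a , (λ ())
...   | yes refl = suc (suc zero) , (λ ()) , (λ ())
∃-≢-both {1} (s≤s ())       _ _
∃-≢-both {2} (s≤s (s≤s ())) _ _

Adj⇒≢ : ∀ {n} (G : SimpleGraph n) {a b} → Adj G a b → a ≢ b
Adj⇒≢ G {a} adj refl = irrefl G a adj

IsMinimum⇒≤ : ∀ {P Q : ℕ → Set} {m s} →
  (∀ {t} → Q t → P t) → IsMinimum P m → Q s → m ≤ s
IsMinimum⇒≤ Q⇒P (_ , minimal) Qs = minimal _ (Q⇒P Qs)

module _ {n t} (B : Fin n → Subset t) where

  IsGCFF⇒Is1CFF : (G : SimpleGraph n) → NoIsolated G →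
    IsGCFF G t B → Is1CFF n t B
  IsGCFF⇒Is1CFF G noIsolated gcff u v u≢v Bu⊆Bv with noIsolated v
  ... | w , v~w with u ≟ w
  ...   | yes refl = let (_ , ¬Bu⊆Bv , _) = gcff v u v~w in ¬Bu⊆Bv Bu⊆Bv
  ...   | no u≢w   = let (_ , _ , uncovered) = gcff v w v~w in
                     uncovered u u≢v u≢w (λ x∈Bu → p⊆p∪q (B w) (Bu⊆Bv x∈Bu))

  Is2CFF⇒Is1CFF : 3 ≤ n → Is2CFF n t B → Is1CFF n t B
  Is2CFF⇒Is1CFF 3≤n cff2 u v u≢v Bu⊆Bv with ∃-≢-both 3≤n u v
  ... | k , k≢u , k≢v =
    cff2 u v k u≢v (≢-sym k≢u) (≢-sym k≢v) (λ x∈Bu → p⊆p∪q (B k) (Bu⊆Bv x∈Bu))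

  Is2CFF⇒IsGCFF : 3 ≤ n → (G : SimpleGraph n) → Is2CFF n t B → IsGCFF G t B
  Is2CFF⇒IsGCFF 3≤n G cff2 a b a~b =
      cff1 a b a≢b
    , cff1 b a (≢-sym a≢b)
    , λ w w≢a w≢b → cff2 w a b w≢a w≢b a≢b
    where
    cff1 = Is2CFF⇒Is1CFF 3≤n cff2
    a≢b  = Adj⇒≢ G a~b

HasGCFF⇒Has1CFF : ∀ {n t} (G : SimpleGraph n) → NoIsolated G →
  HasGCFF G t → Has1CFF n t
HasGCFF⇒Has1CFF G noIsolated (B , gcff) = B , IsGCFF⇒Is1CFF B G noIsolated gcff

Has2CFF⇒HasGCFF : ∀ {n t} → 3 ≤ n → (G : SimpleGraph n) →
  Has2CFF n t → HasGCFF G t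
Has2CFF⇒HasGCFF 3≤n G (B , cff2) = B , Is2CFF⇒IsGCFF B 3≤n G cff2

corollary4p10 : (n : ℕ) → 3 ≤ n → (G : SimpleGraph n) → NoIsolated G →
    (t₁ tG t₂ : ℕ) → IsT1 n t₁ → IsTG G tG → IsT2 n t₂ →
    t₁ ≤ tG × tG ≤ t₂
corollary4p10 n 3≤n G noIsolated t₁ tG t₂ isT1 isTG isT2 =
    IsMinimum⇒≤ (HasGCFF⇒Has1CFF G noIsolated) isT1 (proj₁ isTG)
  , IsMinimum⇒≤ (Has2CFF⇒HasGCFF 3≤n G) isTG (proj₁ isT2)
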